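{- Let $(\mathbb{A},\mathcal{A})$, $(\mathbb{B},\mathcal{B})$ be Boolean kits and $T:\mathrm{StPSh}(\mathbb{A},\mathcal{A})\to\mathrm{StPSh}(\mathbb{B},\mathcal{B})$ a stable functor. Then the trace $\mathrm{tr}(T)$ is a stable species $!(\mathbb{A},\mathcal{A})\to(\mathbb{B},\mathcal{B})$.
   Context: Kits: a kit on a groupoid $\mathbb{A}$ is a family $\mathcal{A}(a)$ of sets of subgroups of $\mathrm{End}(a)=\mathbb{A}(a,a)$ closed under conjugation; subgroups are orthogonal if they intersect in $\{\mathrm{id}\}$; $\mathcal{K}^\perp(a)$ is the set of subgroups orthogonal to all members of $\mathcal{K}(a)$; Boolean means $\mathcal{A}=\mathcal{A}^{\perp\perp}$; $\bigcup\mathcal{A}(a)$ is the union of members. $\mathrm{Sym}\,\mathbb{A}$: finite sequences $\langle a_1,\ldots,a_n\rangle$ with morphisms $(\sigma,(\alpha_i:a_i\to b_{\sigma(i)}))$, $\sigma\in S_n$; for $\alpha=(\sigma,(\alpha_i))\in\mathrm{End}(u)$, $\langle\alpha\rangle_i=\alpha_{\sigma^{o(i)-1}(i)}\circ\cdots\circ\alpha_i$ with $o(i)$ the least $k>0$ with $\sigma^k(i)=i$; $\mathcal{A}^{\mathrm{Sym}}(u)$ = subgroups $H$ with $\langle\alpha\rangle_i\in\bigcup\mathcal{A}(a_i)$ for all $\alpha\in H$, $i$; $!(\mathbb{A},\mathcal{A})=(\mathrm{Sym}\,\mathbb{A},!\mathcal{A})$ with $!\mathcal{A}=(\mathcal{A}^{\mathrm{Sym}})^{\perp\perp}$.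 A stable species $!(\mathbb{A},\mathcal{A})\to(\mathbb{B},\mathcal{B})$ is a functor $P:\mathbb{B}^{op}\times\mathrm{Sym}\,\mathbb{A}\to\mathbf{Set}$ such that whenever $\alpha\cdot p\cdot\beta=p$ ($p\in P(b,u)$, $\alpha\in\mathrm{End}(u)$, $\beta\in\mathrm{End}(b)$): $\alpha\in\bigcup!\mathcal{A}(u)\Rightarrow\beta\in\bigcup\mathcal{B}(b)$ and $\beta\in\bigcup\mathcal{B}^\perp(b)\Rightarrow\alpha\in\bigcup(!\mathcal{A})^\perp(u)$. $\mathrm{StPSh}(\mathbb{A},\mathcal{A})$: full subcategory of presheaves on $\mathbb{A}$ all of whose elements $x\in X(a)$ have stabilizer $\{\alpha:x\cdot\alpha=x\}$ in $\mathcal{A}(a)$. A functor $T$ between such categories is stable if it preserves filtered colimits and epimorphisms and each induced slice functor $\mathrm{StPSh}(\mathbb{A},\mathcal{A})/X\to\mathrm{StPSh}(\mathbb{B},\mathcal{B})/T(X)$ is a right adjoint. For a functor $T$, a morphism $g:Y\to T(X)$ is generic if for every commuting square $T(h)\circ g=T(f)\circ v$ with $h:X\to X''$, $f:X'\to X''$, $v:Y\to T(X')$, there is a unique $k:X\to X'$ with $f\circ k=h$ and $T(k)\circ g=v$. The trace $\mathrm{tr}(T):\mathbb{B}^{op}\times\mathrm{Sym}\,\mathbb{A}\to\mathbf{Set}$ sends $(b,\langle a_1,\ldots,a_n\rangle)$ to the set of generic morphisms $\mathrm{y}(b)\to T(\coprod_i\mathrm{y}(a_i))$, with functorial action by composition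 (a morphism $(\sigma,(\alpha_i))$ of $\mathrm{Sym}\,\mathbb{A}$ acting via the induced isomorphism $\coprod_i\mathrm{y}(a_i)\to\coprod_i\mathrm{y}(b_i)$). -}

module Defs where

open import Level using (0ℓ)
open import Data.Nat using (ℕ; zero; suc; _<_)
open import Data.Fin using (Fin) renaming (_≟_ to _≟F_)
import Data.Fin.Permutation as P
open P using (Permutation; Permutation′; _⟨$⟩ʳ_; _⟨$⟩ˡ_; _∘ₚ_)
open import Data.Product using (Σ; Σ-syntax; _×_; _,_; proj₁; proj₂)
open import Data.Product.Properties using (,-injectiveʳ-UIP)
open import Axiom.UniquenessOfIdentityProofs using (module Decidable⇒UIP)
open import Relation.Binary.Bundles using (Setoid)
import Relation.Binary.PropositionalEquality as Eq
open Eq using (_≡_; refl; sym; trans; cong; subst; _≢_)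

record Groupoid : Set₁ where
  infixr 9 _∘_
  infix 10 _⁻¹
  field
    Obj : Set
    Hom : Obj → Obj → Set
    id  : ∀ {a} → Hom a a
    _∘_ : ∀ {a b c} → Hom b c → Hom a b → Hom a c
    _⁻¹ : ∀ {a b} → Hom a b → Hom b a
    assoc : ∀ {a b c d} (f : Hom c d) (g : Hom b c) (h : Hom a b) →
            (f ∘ g) ∘ h ≡ f ∘ (g ∘ h)
    identityˡ : ∀ {a b} (f : Hom a b) → id ∘ f ≡ f
    identityʳ : ∀ {a b} (f : Hom a b) → f ∘ id ≡ f
    inverseˡ : ∀ {a b} (f : Hom a b) → f ⁻¹ ∘ f ≡ id
    inverseʳ : ∀ {a b} (f : Hom a b) → f ∘ f ⁻¹ ≡ id

record RawGroup : Set₁ where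
  field
    Carrier : Set
    _≈_ : Carrier → Carrier → Set
    ε : Carrier
    _·_ : Carrier → Carrier → Carrier
    inv : Carrier → Carrier

record Subgroup (G : RawGroup) : Set₁ where
  open RawGroup G
  field
    mem : Carrier → Set
    mem-resp : ∀ {x y} → x ≈ y → mem x → mem y
    ε∈ : mem ε
    ·∈ : ∀ {x y} → mem x → mem y → mem (x · y)
    inv∈ : ∀ {x} → mem x → mem (inv x)

open Subgroup public

SubgroupSet : RawGroup → Set₂
SubgroupSet G = Subgroup G → Set₁

Orth : {G : RawGroup} → Subgroup G → Subgroup G → Set
Orth {G} H K = ∀ x → mem H x → mem K x → RawGroup._≈_ G x (RawGroup.ε G)

_⊥ : {G : RawGroup} → SubgroupSet G → SubgroupSet G
(𝒦 ⊥) H = ∀ K → 𝒦 K → Orth H K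

⋃ : {G : RawGroup} → SubgroupSet G → RawGroup.Carrier G → Set₁
⋃ {G} 𝒦 x = Σ[ H ∈ Subgroup G ] (𝒦 H × mem H x)

module _ (𝔸 : Groupoid) where
  open Groupoid 𝔸

  End : Obj → RawGroup
  End a = record { Carrier = Hom a a ; _≈_ = _≡_ ; ε = id ; _·_ = _∘_ ; inv = _⁻¹ }

  -- a kit: for each object a a set of subgroups of End(a), closed under
  -- conjugation (by morphisms of the groupoid): if H ∈ 𝒜(a) and f : a → b
  -- then the subgroup f H f⁻¹ of End(b) is in 𝒜(b).
  record Kit : Set₂ where
    field
      𝒜 : ∀ a → SubgroupSet (End a)
      conj : ∀ {a b} (f : Hom a b) (H : Subgroup (End a)) (K : Subgroup (End b)) →
             (∀ δ → mem K δ → mem H (f ⁻¹ ∘ δ ∘ f)) →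
             (∀ δ → mem H (f ⁻¹ ∘ δ ∘ f) → mem K δ) →
             𝒜 a H → 𝒜 b K

  Boolean : Kit → Set₁
  Boolean K = ∀ a (H : Subgroup (End a)) →
    (Kit.𝒜 K a H → ((Kit.𝒜 K a ⊥) ⊥) H) × (((Kit.𝒜 K a ⊥) ⊥) H → Kit.𝒜 K a H)

module _ {𝔸 : Groupoid} where
  open Groupoid 𝔸

  record SymObj : Set where
    constructor ⟨_,_⟩
    field
      len : ℕ
      obj : Fin len → Obj
  open SymObj public

  record SymHom (u v : SymObj) : Set where
    constructor symHom
    field
      perm : Permutation (len u) (len v)
      comp : ∀ i → Hom (obj u i) (obj v (perm ⟨$⟩ʳ i))
  open SymHom public

  _≈ₛ_ : ∀ {u v} → SymHom u v → SymHom u v → Set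
  _≈ₛ_ {u} {v} α α' =
    Σ[ p ∈ (∀ i → perm α ⟨$⟩ʳ i ≡ perm α' ⟨$⟩ʳ i) ]
      (∀ i → subst (λ j → Hom (obj u i) (obj v j)) (p i) (comp α i) ≡ comp α' i)

  idₛ : ∀ {u} → SymHom u u
  idₛ = symHom P.id (λ _ → id)

  _∘ₛ_ : ∀ {u v w} → SymHom v w → SymHom u v → SymHom u w
  β ∘ₛ α = symHom (perm α ∘ₚ perm β) (λ i → comp β (perm α ⟨$⟩ʳ i) ∘ comp α i)

  invₛ : ∀ {u v} → SymHom u v → SymHom v u
  invₛ {u} {v} α = symHom (P.flip (perm α)) λ j →
    subst (λ k → Hom (obj v k) (obj u (perm α ⟨$⟩ˡ j))) (P.inverseʳ (perm α))
          (comp α (perm α ⟨$⟩ˡ j) ⁻¹)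

  EndSym : SymObj → RawGroup
  EndSym u = record { Carrier = SymHom u u ; _≈_ = _≈ₛ_ ; ε = idₛ ; _·_ = _∘ₛ_ ; inv = invₛ }

  pow : ∀ {n} → Permutation′ n → ℕ → Fin n → Fin n
  pow σ zero i = i
  pow σ (suc k) i = σ ⟨$⟩ʳ pow σ k i

  iterC : ∀ {u} (α : SymHom u u) (k : ℕ) (i : Fin (len u)) →
          Hom (obj u i) (obj u (pow (perm α) k i))
  iterC α zero i = id
  iterC α (suc k) i = comp α (pow (perm α) k i) ∘ iterC α k i

  -- "⟨α⟩_i ∈ U", where ⟨α⟩_i = iterC α (o(i)) i transported along σ^{o(i)}(i) = i,
  -- o(i) being the least k > 0 with σ^k(i) = i.
  CycleIn : ∀ {u} (α : SymHom u u) (i : Fin (len u)) →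
            (Hom (obj u i) (obj u i) → Set₁) → Set₁
  CycleIn {u} α i U =
    ∀ (k : ℕ) → 0 < k → (p : pow (perm α) k i ≡ i) →
    (∀ j → 0 < j → j < k → pow (perm α) j i ≢ i) →
    U (subst (λ j → Hom (obj u i) (obj u j)) p (iterC α k i))

module _ {𝔸 : Groupoid} (K : Kit 𝔸) where
  open Groupoid 𝔸
  open Kit K

  𝒜Sym : ∀ u → SubgroupSet (EndSym {𝔸} u)
  𝒜Sym u H = ∀ α → mem H α → ∀ i → CycleIn α i (⋃ (𝒜 (obj u i)))

  !𝒜 : ∀ u → SubgroupSet (EndSym {𝔸} u)
  !𝒜 u = ((𝒜Sym u) ⊥) ⊥

module _ {𝔸 : Groupoid} where
  open Groupoid 𝔸

  record Presheaf : Set₁ where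
    field
      F : Obj → Setoid 0ℓ 0ℓ
    El : Obj → Set
    El a = Setoid.Carrier (F a)
    field
      act : ∀ {a b} → Hom b a → El a → El b
      act-cong : ∀ {a b} (f : Hom b a) {x y} → Setoid._≈_ (F a) x y → Setoid._≈_ (F b) (act f x) (act f y)
      act-id : ∀ {a} (x : El a) → Setoid._≈_ (F a) (act id x) x
      act-∘ : ∀ {a b c} (f : Hom b a) (g : Hom c b) (x : El a) →
              Setoid._≈_ (F c) (act (f ∘ g) x) (act g (act f x))

  open Presheaf public using (El; act)

  record NT (X Y : Presheaf) : Set where
    field
      η : ∀ a → El X a → El Y a
      η-cong : ∀ a {x y} → Setoid._≈_ (Presheaf.F X a) x y → Setoid._≈_ (Presheaf.F Y a) (η a x) (η a y)
      natural : ∀ {a b} (f : Hom b a) (x : El X a) →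
                Setoid._≈_ (Presheaf.F Y b) (η b (act X f x)) (act Y f (η a x))
  open NT public

  _≈NT_ : ∀ {X Y} → NT X Y → NT X Y → Set
  _≈NT_ {X} {Y} s t = ∀ a (x : El X a) → Setoid._≈_ (Presheaf.F Y a) (η s a x) (η t a x)

  idNT : ∀ {X} → NT X X
  idNT {X} = record
    { η = λ _ x → x
    ; η-cong = λ _ p → p
    ; natural = λ f x → Setoid.refl (Presheaf.F X _) }

  infixr 9 _∘NT_
  _∘NT_ : ∀ {X Y Z} → NT Y Z → NT X Y → NT X Z
  _∘NT_ {X} {Y} {Z} t s = record
    { η = λ a x → η t a (η s a x)
    ; η-cong = λ a p → η-cong t a (η-cong s a p)
    ; natural = λ f x → Setoid.trans (Presheaf.F Z _)
        (η-cong t _ (natural s f x)) (natural t f (η s _ x)) }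

  Stab : (X : Presheaf) {a : Obj} → El X a → Subgroup (End 𝔸 a)
  Stab X {a} x = record
    { mem = λ γ → Setoid._≈_ (Presheaf.F X a) (Presheaf.act X γ x) x
    ; mem-resp = λ { refl p → p }
    ; ε∈ = act-id x
    ; ·∈ = λ {γ} {δ} pγ pδ → trans' (act-∘ γ δ x) (trans' (act-cong δ pγ) pδ)
    ; inv∈ = λ {γ} pγ →
        trans' (act-cong (γ ⁻¹) (sym' pγ))
        (trans' (sym' (act-∘ γ (γ ⁻¹) x))
        (trans' (Setoid.reflexive (F a) (cong (λ h → Presheaf.act X h x) (inverseʳ γ)))
                (act-id x)))
    }
    where
      open Presheaf X
      trans' = Setoid.trans (F a)
      sym' = Setoid.sym (F a)

  y : Obj → Presheaf
  y b = record
    { F = λ b' → Eq.setoid (Hom b' b)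
    ; act = λ γ f → f ∘ γ
    ; act-cong = λ γ p → cong (_∘ γ) p
    ; act-id = identityʳ
    ; act-∘ = λ f g x → sym (assoc x f g) }

  yHom : ∀ {b' b} → Hom b' b → NT (y b') (y b)
  yHom β = record
    { η = λ _ f → β ∘ f
    ; η-cong = λ _ p → cong (β ∘_) p
    ; natural = λ f x → sym (assoc β x f) }

  ∐y : SymObj {𝔸} → Presheaf
  ∐y u = record
    { F = λ a → Eq.setoid (Σ (Fin (len u)) (λ i → Hom a (obj u i)))
    ; act = λ { γ (i , f) → (i , f ∘ γ) }
    ; act-cong = λ γ p → cong (λ { (i , f) → (i , f ∘ γ) }) p
    ; act-id = λ { (i , f) → cong (i ,_) (identityʳ f) }
    ; act-∘ = λ { f g (i , x) → cong (i ,_) (sym (assoc x f g)) } }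

  ιHom : ∀ {u v} → SymHom u v → NT (∐y u) (∐y v)
  ιHom α = record
    { η = λ { _ (i , f) → (perm α ⟨$⟩ʳ i , comp α i ∘ f) }
    ; η-cong = λ _ p → cong (λ { (i , f) → (perm α ⟨$⟩ʳ i , comp α i ∘ f) }) p
    ; natural = λ { γ (i , f) → cong (perm α ⟨$⟩ʳ i ,_) (sym (assoc (comp α i) f γ)) } }

  cancelˡ : ∀ {a b} (f : Hom a b) (γ : Hom a a) → f ∘ γ ≡ f → γ ≡ id
  cancelˡ f γ e =
    trans (sym (identityˡ γ))
    (trans (cong (_∘ γ) (sym (inverseˡ f)))
    (trans (assoc (f ⁻¹) f γ)
    (trans (cong (f ⁻¹ ∘_) e) (inverseˡ f))))

module _ {𝔸 : Groupoid} (K : Kit 𝔸) where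
  open Groupoid 𝔸
  open Kit K

  record StObj : Set₁ where
    field
      psh : Presheaf {𝔸}
      stable : ∀ a (x : El psh a) → 𝒜 a (Stab psh x)
  open StObj public

  record StHom (X Y : StObj) : Set where
    constructor st
    field
      nt : NT (psh X) (psh Y)
  open StHom public

module _ {𝔸 : Groupoid} {K : Kit 𝔸} where

  infix 4 _≈St_
  _≈St_ : ∀ {X Y} → StHom K X Y → StHom K X Y → Set
  f ≈St g = nt f ≈NT nt g

  infixr 9 _∘St_
  _∘St_ : ∀ {X Y Z} → StHom K Y Z → StHom K X Y → StHom K X Z
  g ∘St f = st (nt g ∘NT nt f)

  idSt : ∀ {X} → StHom K X X
  idSt = st idNT

module _ {𝔸 : Groupoid} (K : Kit 𝔸) where
  open Groupoid 𝔸
  open Kit K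

  IsEpi : ∀ {X Y} → StHom K X Y → Set₁
  IsEpi {X} {Y} e = ∀ (Z : StObj K) (f g : StHom K Y Z) → (f ∘St e) ≈St (g ∘St e) → f ≈St g

  ∐St : Boolean 𝔸 K → SymObj {𝔸} → StObj K
  ∐St bool u = record
    { psh = ∐y u
    ; stable = λ { a (i , f) → proj₂ (bool a (Stab (∐y u) (i , f)))
        (λ H _ γ pγ _ → cancelˡ {𝔸} f γ
          (,-injectiveʳ-UIP (Decidable⇒UIP.≡-irrelevant _≟F_) pγ)) } }

record Category : Set₁ where
  infixr 9 _∘_
  field
    Obj : Set
    Hom : Obj → Obj → Set
    id  : ∀ {a} → Hom a a
    _∘_ : ∀ {a b c} → Hom b c → Hom a b → Hom a c
    assoc : ∀ {a b c d} (f : Hom c d) (g : Hom b c) (h : Hom a b) →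
            (f ∘ g) ∘ h ≡ f ∘ (g ∘ h)
    identityˡ : ∀ {a b} (f : Hom a b) → id ∘ f ≡ f
    identityʳ : ∀ {a b} (f : Hom a b) → f ∘ id ≡ f

IsFiltered : Category → Set
IsFiltered 𝕀 =
  Obj ×
  (∀ i j → Σ[ k ∈ Obj ] (Hom i k × Hom j k)) ×
  (∀ {i j} (u v : Hom i j) → Σ[ k ∈ Obj ] Σ[ w ∈ Hom j k ] (w ∘ u ≡ w ∘ v))
  where open Category 𝕀

module _ {𝔸 : Groupoid} (K : Kit 𝔸) (𝕀 : Category) where
  open Category 𝕀

  record Diagram : Set₁ where
    field
      D₀ : Obj → StObj K
      D₁ : ∀ {i j} → Hom i j → StHom K (D₀ i) (D₀ j)
      D-id : ∀ {i} → D₁ (id {i}) ≈St idSt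
      D-∘ : ∀ {i j k} (v : Hom j k) (u : Hom i j) → D₁ (v ∘ u) ≈St (D₁ v ∘St D₁ u)

  IsCocone : (D₀ : Obj → StObj K) (D₁ : ∀ {i j} → Hom i j → StHom K (D₀ i) (D₀ j))
             (C : StObj K) → (∀ i → StHom K (D₀ i) C) → Set
  IsCocone D₀ D₁ C μ = ∀ {i j} (u : Hom i j) → (μ j ∘St D₁ u) ≈St μ i

  IsColimit : (D₀ : Obj → StObj K) (D₁ : ∀ {i j} → Hom i j → StHom K (D₀ i) (D₀ j))
              (L : StObj K) → (∀ i → StHom K (D₀ i) L) → Set₁
  IsColimit D₀ D₁ L λ′ =
    ∀ (C : StObj K) (μ : ∀ i → StHom K (D₀ i) C) → IsCocone D₀ D₁ C μ →
    Σ[ m ∈ StHom K L C ] ((∀ i → (m ∘St λ′ i) ≈St μ i) ×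
      (∀ (m' : StHom K L C) → (∀ i → (m' ∘St λ′ i) ≈St μ i) → m' ≈St m))

module _ {𝔸 𝔹 : Groupoid} (KA : Kit 𝔸) (KB : Kit 𝔹) where

  record StFunctor : Set₁ where
    field
      F₀ : StObj KA → StObj KB
      F₁ : ∀ {X Y} → StHom KA X Y → StHom KB (F₀ X) (F₀ Y)
      F-resp : ∀ {X Y} {f g : StHom KA X Y} → f ≈St g → F₁ f ≈St F₁ g
      F-id : ∀ {X} → F₁ (idSt {X = X}) ≈St idSt
      F-∘ : ∀ {X Y Z} (g : StHom KA Y Z) (f : StHom KA X Y) →
            F₁ (g ∘St f) ≈St (F₁ g ∘St F₁ f)
  open StFunctor public

  module _ (T : StFunctor) where

    PreservesFilteredColimits : Set₁
    PreservesFilteredColimits =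
      ∀ (𝕀 : Category) → IsFiltered 𝕀 → (D : Diagram KA 𝕀) (L : StObj KA)
        (λ′ : ∀ i → StHom KA (Diagram.D₀ D i) L) →
        IsCocone KA 𝕀 (Diagram.D₀ D) (Diagram.D₁ D) L λ′ →
        IsColimit KA 𝕀 (Diagram.D₀ D) (Diagram.D₁ D) L λ′ →
        IsColimit KB 𝕀 (λ i → F₀ T (Diagram.D₀ D i)) (λ u → F₁ T (Diagram.D₁ D u))
                  (F₀ T L) (λ i → F₁ T (λ′ i))

    PreservesEpis : Set₁
    PreservesEpis = ∀ {X Y} (e : StHom KA X Y) → IsEpi KA e → IsEpi KB (F₁ T e)

    -- the slice functor StPSh(𝔸,𝒜)/X → StPSh(𝔹,ℬ)/T(X), (Z,f) ↦ (TZ,Tf), is a right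
    -- adjoint: every object (Y,g) of StPSh(𝔹,ℬ)/T(X) has a universal arrow to it.
    SliceRightAdjoint : Set₁
    SliceRightAdjoint =
      ∀ (X : StObj KA) (Y : StObj KB) (g : StHom KB Y (F₀ T X)) →
      Σ[ Z ∈ StObj KA ] Σ[ f ∈ StHom KA Z X ] Σ[ η′ ∈ StHom KB Y (F₀ T Z) ]
        (((F₁ T f ∘St η′) ≈St g) ×
         (∀ (Z' : StObj KA) (f' : StHom KA Z' X) (v : StHom KB Y (F₀ T Z')) →
            (F₁ T f' ∘St v) ≈St g →
            Σ[ k ∈ StHom KA Z Z' ] (((f' ∘St k) ≈St f) × ((F₁ T k ∘St η′) ≈St v) ×
              (∀ (k' : StHom KA Z Z') → (f' ∘St k') ≈St f → (F₁ T k' ∘St η′) ≈St v →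
                 k' ≈St k))))

    IsStableFunctor : Set₁
    IsStableFunctor = PreservesFilteredColimits × PreservesEpis × SliceRightAdjoint

    IsGeneric : {Y : Presheaf {𝔹}} {X : StObj KA} → NT Y (psh (F₀ T X)) → Set₁
    IsGeneric {Y} {X} g =
      ∀ (X' X'' : StObj KA) (h : StHom KA X X'') (f : StHom KA X' X'')
        (v : NT Y (psh (F₀ T X'))) →
        (nt (F₁ T h) ∘NT g) ≈NT (nt (F₁ T f) ∘NT v) →
        Σ[ k ∈ StHom KA X X' ] (((f ∘St k) ≈St h) × ((nt (F₁ T k) ∘NT g) ≈NT v) ×
          (∀ (k' : StHom KA X X') → (f ∘St k') ≈St h → (nt (F₁ T k') ∘NT g) ≈NT v →
             k' ≈St k))

module _ {𝔸 𝔹 : Groupoid} {KA : Kit 𝔸} {KB : Kit 𝔹}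
         (boolA : Boolean 𝔸 KA) (T : StFunctor KA KB) where
  open Groupoid 𝔹 renaming (Hom to HomB; _∘_ to _∘B_; id to idB)

  TrMor : Groupoid.Obj 𝔹 → SymObj {𝔸} → Set
  TrMor b u = NT (y b) (psh (F₀ T (∐St KA boolA u)))

  TrEl : Groupoid.Obj 𝔹 → SymObj {𝔸} → Set₁
  TrEl b u = Σ[ g ∈ TrMor b u ] IsGeneric KA KB T g

  -- action of (β : b' → b in 𝔹, i.e. b → b' in 𝔹^op ; α : u → v in Sym 𝔸):
  -- g ↦ T(ι_α) ∘ g ∘ y(β)
  trAct : ∀ {b' b u v} → HomB b' b → SymHom u v → TrMor b u → TrMor b' v
  trAct {u = u} {v} β α g =
    nt (F₁ T {∐St KA boolA u} {∐St KA boolA v} (st (ιHom α))) ∘NT (g ∘NT yHom β)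

  -- tr(T) is a stable species !(𝔸,𝒜) → (𝔹,ℬ): it is a well-defined functor
  -- 𝔹^op × Sym 𝔸 → Set (the action preserves genericity, respects equality,
  -- identities and composition) satisfying the two stability conditions.
  record TraceIsStableSpecies : Set₂ where
    field
      gen-closed : ∀ {b' b u v} (β : HomB b' b) (α : SymHom u v) (g : TrMor b u) →
                   IsGeneric KA KB T g → IsGeneric KA KB T (trAct β α g)
      resp-el : ∀ {b' b u v} (β : HomB b' b) (α : SymHom u v) (g g' : TrMor b u) →
                IsGeneric KA KB T g → IsGeneric KA KB T g' →
                g ≈NT g' → trAct β α g ≈NT trAct β α g'
      resp-hom : ∀ {b' b u v} (β : HomB b' b) (α α' : SymHom u v) (g : TrMor b u) →
                 IsGeneric KA KB T g → α ≈ₛ α' → trAct β α g ≈NT trAct β α' g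
      act-id : ∀ {b u} (g : TrMor b u) → IsGeneric KA KB T g →
               trAct idB idₛ g ≈NT g
      act-∘ : ∀ {b'' b' b u v w} (β₂ : HomB b'' b') (β₁ : HomB b' b)
                (α₂ : SymHom v w) (α₁ : SymHom u v) (g : TrMor b u) →
              IsGeneric KA KB T g →
              trAct (β₁ ∘B β₂) (α₂ ∘ₛ α₁) g ≈NT trAct β₂ α₂ (trAct β₁ α₁ g)
      stable-! : ∀ {b u} (g : TrMor b u) → IsGeneric KA KB T g →
                 (α : SymHom u u) (β : HomB b b) → trAct β α g ≈NT g →
                 ⋃ (!𝒜 KA u) α → ⋃ (Kit.𝒜 KB b) β
      stable-⊥ : ∀ {b u} (g : TrMor b u) → IsGeneric KA KB T g →
                 (α : SymHom u u) (β : HomB b b) → trAct β α g ≈NT g →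
                 ⋃ (Kit.𝒜 KB b ⊥) β → ⋃ (!𝒜 KA u ⊥) α

-- A pair (β, α) ∈ End(b) × End(u) acts on g : y(b) → T(∐ᵢ y(aᵢ)) through y(β) and the
-- isomorphism ι_α, and the pairs fixing g form a subgroup.  Two facts about a fixing pair
-- carry the proof.  If q : ∐ᵢ y(aᵢ) → Z is a map into a stable presheaf with q ∘ ι_α = q,
-- then β stabilises T(q)(g(id)) ∈ T(Z)(b), so β ∈ ⋃ ℬ(b).  If β = id and α lies in some
-- H ∈ 𝒜^Sym(u), then the presheaf of H-orbits of ∐ᵢ y(aᵢ) is stable (its stabilisers
-- consist of conjugates of the cycles ⟨γ⟩ᵢ, and 𝒜 is Boolean), and genericity of g against
-- the orbit map forces ι_α = id.  Together: for K ∈ ℬ^⊥, the α partnered with some β ∈ K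
-- form a subgroup in (𝒜^Sym)^⊥.  This is the ⊥-condition, and with Booleanness of ℬ it
-- gives the other one.

module Submission where

open import Defs
open import Level using (0ℓ)
open import Data.Nat using (s≤s; z≤n)
open import Data.Fin using (Fin) renaming (_≟_ to _≟F_)
import Data.Fin.Permutation as P
open P using (_⟨$⟩ʳ_; _⟨$⟩ˡ_)
open import Data.Product using (Σ; Σ-syntax; _×_; _,_; proj₁; proj₂)
open import Data.Product.Properties using (,-injectiveʳ-≡; Σ-≡,≡→≡)
open import Axiom.UniquenessOfIdentityProofs using (module Decidable⇒UIP)
open import Relation.Binary.Bundles using (Setoid)
import Relation.Binary.Reasoning.Setoid as SetoidReasoning
open import Relation.Binary.PropositionalEquality
  using (_≡_; refl; sym; trans; cong; subst; module ≡-Reasoning)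
open import Relation.Binary.PropositionalEquality.Properties using (subst-application′)

Fin-UIP : ∀ {n} {i j : Fin n} (p q : i ≡ j) → p ≡ q
Fin-UIP = Decidable⇒UIP.≡-irrelevant _≟F_

module _ {G : RawGroup} where

  Orth-sym : {H K : Subgroup G} → Orth H K → Orth K H
  Orth-sym H⊥K x x∈K x∈H = H⊥K x x∈H x∈K

  ⊥⇒⊥⊥⊥ : {𝒦 : SubgroupSet G} {H : Subgroup G} → (𝒦 ⊥) H → (((𝒦 ⊥) ⊥) ⊥) H
  ⊥⇒⊥⊥⊥ {H = H} H∈𝒦⊥ L L∈𝒦⊥⊥ = Orth-sym {H = L} {K = H} (L∈𝒦⊥⊥ H H∈𝒦⊥)

  ⊥-∩-⋃⇒≈ε : {𝒦 : SubgroupSet G} {K : Subgroup G} {x : RawGroup.Carrier G} →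
              (𝒦 ⊥) K → mem K x → ⋃ 𝒦 x → RawGroup._≈_ G x (RawGroup.ε G)
  ⊥-∩-⋃⇒≈ε {x = x} K∈𝒦⊥ x∈K (L , L∈𝒦 , x∈L) = K∈𝒦⊥ L L∈𝒦 x x∈K x∈L

  ⊆⋃⇒⊥⊥ : {𝒦 : SubgroupSet G} (H : Subgroup G) → (∀ x → mem H x → ⋃ 𝒦 x) → ((𝒦 ⊥) ⊥) H
  ⊆⋃⇒⊥⊥ {𝒦} H H⊆⋃𝒦 K K∈𝒦⊥ x x∈H x∈K = ⊥-∩-⋃⇒≈ε {𝒦 = 𝒦} {K} K∈𝒦⊥ x∈K (H⊆⋃𝒦 x x∈H)

module GroupoidProperties (𝔸 : Groupoid) where
  open Groupoid 𝔸
  open ≡-Reasoning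

  ⁻¹-cancelˡ : ∀ {a b c} (f : Hom b c) (g : Hom a b) → f ⁻¹ ∘ f ∘ g ≡ g
  ⁻¹-cancelˡ f g = begin
    f ⁻¹ ∘ f ∘ g    ≡⟨ assoc (f ⁻¹) f g ⟨
    (f ⁻¹ ∘ f) ∘ g  ≡⟨ cong (_∘ g) (inverseˡ f) ⟩
    id ∘ g          ≡⟨ identityˡ g ⟩
    g               ∎

  ⁻¹-cancelʳ : ∀ {a b c} (f : Hom c b) (g : Hom a b) → f ∘ f ⁻¹ ∘ g ≡ g
  ⁻¹-cancelʳ f g = begin
    f ∘ f ⁻¹ ∘ g    ≡⟨ assoc f (f ⁻¹) g ⟨
    (f ∘ f ⁻¹) ∘ g  ≡⟨ cong (_∘ g) (inverseʳ f) ⟩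
    id ∘ g          ≡⟨ identityˡ g ⟩
    g               ∎

  ⁻¹-uniqueʳ : ∀ {a b} (f : Hom a b) (g : Hom b a) → f ∘ g ≡ id → g ≡ f ⁻¹
  ⁻¹-uniqueʳ f g f∘g≡id = begin
    g             ≡⟨ ⁻¹-cancelˡ f g ⟨
    f ⁻¹ ∘ f ∘ g  ≡⟨ cong (f ⁻¹ ∘_) f∘g≡id ⟩
    f ⁻¹ ∘ id     ≡⟨ identityʳ (f ⁻¹) ⟩
    f ⁻¹          ∎

  ⁻¹-involutive : ∀ {a b} (f : Hom a b) → (f ⁻¹) ⁻¹ ≡ f
  ⁻¹-involutive f = sym (⁻¹-uniqueʳ (f ⁻¹) f (inverseˡ f))

  conj-id : ∀ {a b} (f : Hom a b) → f ⁻¹ ∘ id ∘ f ≡ id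
  conj-id f = trans (cong (f ⁻¹ ∘_) (identityˡ f)) (inverseˡ f)

  conj-∘ : ∀ {a b} (f : Hom a b) (δ δ′ : Hom b b) →
           (f ⁻¹ ∘ δ ∘ f) ∘ (f ⁻¹ ∘ δ′ ∘ f) ≡ f ⁻¹ ∘ (δ ∘ δ′) ∘ f
  conj-∘ f δ δ′ = begin
    (f ⁻¹ ∘ δ ∘ f) ∘ (f ⁻¹ ∘ δ′ ∘ f)  ≡⟨ assoc (f ⁻¹) (δ ∘ f) _ ⟩
    f ⁻¹ ∘ (δ ∘ f) ∘ f ⁻¹ ∘ δ′ ∘ f    ≡⟨ cong (f ⁻¹ ∘_) (assoc δ f _) ⟩
    f ⁻¹ ∘ δ ∘ f ∘ f ⁻¹ ∘ δ′ ∘ f      ≡⟨ cong (λ h → f ⁻¹ ∘ δ ∘ h) (⁻¹-cancelʳ f (δ′ ∘ f)) ⟩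
    f ⁻¹ ∘ δ ∘ δ′ ∘ f                 ≡⟨ cong (f ⁻¹ ∘_) (assoc δ δ′ f) ⟨
    f ⁻¹ ∘ (δ ∘ δ′) ∘ f               ∎

  conj-⁻¹ : ∀ {a b} (f : Hom a b) (δ : Hom b b) → f ⁻¹ ∘ δ ⁻¹ ∘ f ≡ (f ⁻¹ ∘ δ ∘ f) ⁻¹
  conj-⁻¹ f δ = ⁻¹-uniqueʳ (f ⁻¹ ∘ δ ∘ f) (f ⁻¹ ∘ δ ⁻¹ ∘ f) (begin
    (f ⁻¹ ∘ δ ∘ f) ∘ (f ⁻¹ ∘ δ ⁻¹ ∘ f)  ≡⟨ conj-∘ f δ (δ ⁻¹) ⟩
    f ⁻¹ ∘ (δ ∘ δ ⁻¹) ∘ f               ≡⟨ cong (λ h → f ⁻¹ ∘ h ∘ f) (inverseʳ δ) ⟩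
    f ⁻¹ ∘ id ∘ f                       ≡⟨ conj-id f ⟩
    id                                  ∎)

  conjugate : ∀ {a b} → Hom a b → Subgroup (End 𝔸 a) → Subgroup (End 𝔸 b)
  conjugate f H = record
    { mem = λ δ → mem H (f ⁻¹ ∘ δ ∘ f)
    ; mem-resp = λ { refl δ∈ → δ∈ }
    ; ε∈ = mem-resp H (sym (conj-id f)) (ε∈ H)
    ; ·∈ = λ δ∈ δ′∈ → mem-resp H (conj-∘ f _ _) (·∈ H δ∈ δ′∈)
    ; inv∈ = λ δ∈ → mem-resp H (sym (conj-⁻¹ f _)) (inv∈ H δ∈) }

  ∈conjugate⁻¹ : ∀ {a b} (f : Hom a b) {c : Hom b b} {δ : Hom a a} (L : Subgroup (End 𝔸 b)) →
                 mem L c → c ∘ f ∘ δ ≡ f → mem (conjugate (f ⁻¹) L) δ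
  ∈conjugate⁻¹ f {c} {δ} L c∈L c∘f∘δ≡f = mem-resp L (sym f∘δ∘f⁻¹≡c⁻¹) (inv∈ L c∈L)
    where
      c∘f∘δ∘f⁻¹≡id : c ∘ f ∘ δ ∘ f ⁻¹ ≡ id
      c∘f∘δ∘f⁻¹≡id = begin
        c ∘ f ∘ δ ∘ f ⁻¹      ≡⟨ cong (c ∘_) (assoc f δ (f ⁻¹)) ⟨
        c ∘ (f ∘ δ) ∘ f ⁻¹    ≡⟨ assoc c (f ∘ δ) (f ⁻¹) ⟨
        (c ∘ f ∘ δ) ∘ f ⁻¹    ≡⟨ cong (_∘ f ⁻¹) c∘f∘δ≡f ⟩
        f ∘ f ⁻¹              ≡⟨ inverseʳ f ⟩
        id                    ∎
      f∘δ∘f⁻¹≡c⁻¹ : (f ⁻¹) ⁻¹ ∘ δ ∘ f ⁻¹ ≡ c ⁻¹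
      f∘δ∘f⁻¹≡c⁻¹ = trans (cong (λ h → h ∘ δ ∘ f ⁻¹) (⁻¹-involutive f))
                          (⁻¹-uniqueʳ c _ c∘f∘δ∘f⁻¹≡id)

module _ {𝔸 : Groupoid} where
  open Groupoid 𝔸
  open GroupoidProperties 𝔸

  NT-setoid : Presheaf {𝔸} → Presheaf {𝔸} → Setoid 0ℓ 0ℓ
  NT-setoid X Y = record
    { Carrier = NT X Y
    ; _≈_ = _≈NT_
    ; isEquivalence = record
      { refl = λ a x → Setoid.refl (Presheaf.F Y a)
      ; sym = λ s≈t a x → Setoid.sym (Presheaf.F Y a) (s≈t a x)
      ; trans = λ s≈t t≈r a x → Setoid.trans (Presheaf.F Y a) (s≈t a x) (t≈r a x) } }

  module ≈NT {X Y : Presheaf {𝔸}} = Setoid (NT-setoid X Y)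

  module _ {X Y Z : Presheaf {𝔸}} where

    ∘NT-congˡ : (t : NT Y Z) {s s′ : NT X Y} → s ≈NT s′ → (t ∘NT s) ≈NT (t ∘NT s′)
    ∘NT-congˡ t s≈s′ a x = η-cong t a (s≈s′ a x)

    ∘NT-congʳ : (s : NT X Y) {t t′ : NT Y Z} → t ≈NT t′ → (t ∘NT s) ≈NT (t′ ∘NT s)
    ∘NT-congʳ s t≈t′ a x = t≈t′ a (η s a x)

  module _ {X Y Z : Presheaf {𝔸}} {e : NT X Y} {e⁻ : NT Y X} where

    switch-toʳ : (e ∘NT e⁻) ≈NT idNT → {s : NT Y Z} {t : NT X Z} →
                 (s ∘NT e) ≈NT t → s ≈NT (t ∘NT e⁻)
    switch-toʳ e∘e⁻≈id {s} {t} s∘e≈t = begin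
      s                 ≈⟨ ∘NT-congˡ s {e ∘NT e⁻} {idNT} e∘e⁻≈id ⟨
      s ∘NT e ∘NT e⁻    ≈⟨ ∘NT-congʳ e⁻ {s ∘NT e} {t} s∘e≈t ⟩
      t ∘NT e⁻          ∎
      where open SetoidReasoning (NT-setoid Y Z)

    switch-fromʳ : (e⁻ ∘NT e) ≈NT idNT → {s : NT Y Z} {t : NT X Z} →
                   s ≈NT (t ∘NT e⁻) → (s ∘NT e) ≈NT t
    switch-fromʳ e⁻∘e≈id {s} {t} s≈t∘e⁻ = begin
      s ∘NT e           ≈⟨ ∘NT-congʳ e {s} {t ∘NT e⁻} s≈t∘e⁻ ⟩
      t ∘NT e⁻ ∘NT e    ≈⟨ ∘NT-congˡ t {e⁻ ∘NT e} {idNT} e⁻∘e≈id ⟩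
      t                 ∎
      where open SetoidReasoning (NT-setoid X Z)

  module _ {b : Obj} where

    yHom-id : yHom {𝔸} (id {b}) ≈NT idNT
    yHom-id a = identityˡ

    yHom-∘ : ∀ {b′ b″} (β₁ : Hom b′ b) (β₂ : Hom b″ b′) →
             yHom {𝔸} (β₁ ∘ β₂) ≈NT (yHom {𝔸} β₁ ∘NT yHom {𝔸} β₂)
    yHom-∘ β₁ β₂ a = assoc β₁ β₂

    yHom-inverseʳ : ∀ {b′} (β : Hom b′ b) → (yHom {𝔸} β ∘NT yHom {𝔸} (β ⁻¹)) ≈NT idNT
    yHom-inverseʳ β a = ⁻¹-cancelʳ β

    yHom-inverseˡ : ∀ {b′} (β : Hom b b′) → (yHom {𝔸} (β ⁻¹) ∘NT yHom {𝔸} β) ≈NT idNT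
    yHom-inverseˡ β a = ⁻¹-cancelˡ β

    yoneda-Stab : {X : Presheaf {𝔸}} (t : NT (y {𝔸} b) X) {β : Hom b b} →
                  (t ∘NT yHom {𝔸} β) ≈NT t → mem (Stab X (η t b id)) β
    yoneda-Stab {X} t {β} t∘β≈t = begin
      act X β (η t b id)  ≈⟨ natural t β id ⟨
      η t b (id ∘ β)      ≡⟨ cong (η t b) (trans (identityˡ β) (sym (identityʳ β))) ⟩
      η t b (β ∘ id)      ≈⟨ t∘β≈t b id ⟩
      η t b id            ∎
      where open SetoidReasoning (Presheaf.F X b)

  module _ {u : SymObj {𝔸}} {a : Obj} where

    ,-∘-injectiveʳ : ∀ {i j} (p : j ≡ i) (h : Hom (obj u i) (obj u j)) (g f : Hom a (obj u i)) →
                     _≡_ {A = El (∐y u) a} (j , h ∘ g) (i , f) →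
                     subst (λ k → Hom (obj u i) (obj u k)) p h ∘ g ≡ f
    ,-∘-injectiveʳ {i} p h g f j,h∘g≡i,f =
      trans (sym (subst-application′ (λ k → Hom (obj u i) (obj u k))
                                     {λ k → Hom a (obj u k)} (λ _ h′ → h′ ∘ g) p))
            (,-injectiveʳ-≡ Fin-UIP j,h∘g≡i,f p)

  module _ {u v : SymObj {𝔸}} where

    ι-resp : {α α′ : SymHom u v} → α ≈ₛ α′ → ιHom α ≈NT ιHom α′
    ι-resp {α} {α′} (σ≡σ′ , comp≡comp′) a (i , f) = Σ-≡,≡→≡ (σ≡σ′ i , (begin
      subst (λ k → Hom a (obj v k)) (σ≡σ′ i) (comp α i ∘ f)
        ≡⟨ subst-application′ (λ k → Hom (obj u i) (obj v k)) (λ _ h → h ∘ f) (σ≡σ′ i) ⟩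
      subst (λ k → Hom (obj u i) (obj v k)) (σ≡σ′ i) (comp α i) ∘ f
        ≡⟨ cong (_∘ f) (comp≡comp′ i) ⟩
      comp α′ i ∘ f ∎))
      where open ≡-Reasoning

    ι-invˡ : (α : SymHom u v) → (ιHom (invₛ α) ∘NT ιHom α) ≈NT idNT
    ι-invˡ α a (i , f) = cancel (P.inverseˡ (perm α)) (P.inverseʳ (perm α))
      where
        cancel : ∀ {i′} (i′≡i : i′ ≡ i) (σi′≡σi : perm α ⟨$⟩ʳ i′ ≡ perm α ⟨$⟩ʳ i) →
                 _≡_ {A = El (∐y u) a}
                   (i′ , subst (λ k → Hom (obj v k) (obj u i′)) σi′≡σi (comp α i′ ⁻¹)
                           ∘ comp α i ∘ f)
                   (i , f)
        cancel refl σi≡σi rewrite Fin-UIP σi≡σi refl = cong (i ,_) (⁻¹-cancelˡ (comp α i) f)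

    ι-invʳ : (α : SymHom u v) → (ιHom α ∘NT ιHom (invₛ α)) ≈NT idNT
    ι-invʳ α a (j , f) = cancel (P.inverseʳ (perm α)) (comp α (perm α ⟨$⟩ˡ j))
      where
        cancel : ∀ {m} (m≡j : m ≡ j) (h : Hom (obj u (perm α ⟨$⟩ˡ j)) (obj v m)) →
                 _≡_ {A = El (∐y v) a}
                   (m , h ∘ subst (λ k → Hom (obj v k) (obj u (perm α ⟨$⟩ˡ j))) m≡j (h ⁻¹) ∘ f)
                   (j , f)
        cancel refl h = cong (j ,_) (⁻¹-cancelʳ h f)

  ι-id : ∀ {u} → ιHom (idₛ {𝔸} {u}) ≈NT idNT
  ι-id a (i , f) = cong (i ,_) (identityˡ f)

  ι-∘ : ∀ {u v w} (α₂ : SymHom {𝔸} v w) (α₁ : SymHom u v) →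
        ιHom (α₂ ∘ₛ α₁) ≈NT (ιHom α₂ ∘NT ιHom α₁)
  ι-∘ α₂ α₁ a (i , f) = cong (_ ,_) (assoc _ _ f)

  ι≈id⇒≈ₛidₛ : ∀ {u : SymObj {𝔸}} {α : SymHom u u} → ιHom α ≈NT idNT → α ≈ₛ idₛ
  ι≈id⇒≈ₛidₛ {u} {α} ια≈id = (λ i → cong proj₁ (fixes i)) , λ i →
    trans (sym (identityʳ _)) (,-∘-injectiveʳ (cong proj₁ (fixes i)) (comp α i) id id (fixes i))
    where
      fixes : ∀ i → _≡_ {A = El (∐y u) (obj u i)} (perm α ⟨$⟩ʳ i , comp α i ∘ id) (i , id)
      fixes i = ια≈id (obj u i) (i , id)

  fixed-point-CycleIn : ∀ {u : SymObj {𝔸}} (γ : SymHom u u) {i} (σi≡i : perm γ ⟨$⟩ʳ i ≡ i)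
                        {U : Hom (obj u i) (obj u i) → Set₁} → CycleIn γ i U →
                        U (subst (λ j → Hom (obj u i) (obj u j)) σi≡i (comp γ i ∘ id))
  fixed-point-CycleIn γ σi≡i cycle = cycle 1 (s≤s z≤n) σi≡i λ { _ (s≤s _) (s≤s ()) }

  module _ {u : SymObj {𝔸}} (H : Subgroup (EndSym u)) where

    _~_ : ∀ {a} → El (∐y u) a → El (∐y u) a → Set
    _~_ {a} x x′ = Σ[ γ ∈ SymHom u u ] (mem H γ × η (ιHom γ) a x ≡ x′)

    ≡⇒~ : ∀ {a} {x x′ : El (∐y u) a} → x ≡ x′ → x ~ x′
    ≡⇒~ {a} {x} x≡x′ = idₛ , ε∈ H , trans (ι-id a x) x≡x′

    ~-setoid : Obj → Setoid 0ℓ 0ℓ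
    ~-setoid a = record
      { Carrier = El (∐y u) a
      ; _≈_ = _~_
      ; isEquivalence = record
        { refl = ≡⇒~ refl
        ; sym = λ { {x} (γ , γ∈H , γx≡x′) → invₛ γ , inv∈ H γ∈H ,
                    trans (cong (η (ιHom (invₛ γ)) a) (sym γx≡x′)) (ι-invˡ γ a x) }
        ; trans = λ { {x} (γ , γ∈H , γx≡x′) (γ′ , γ′∈H , γ′x′≡x″) → γ′ ∘ₛ γ , ·∈ H γ′∈H γ∈H ,
                      trans (ι-∘ γ′ γ a x) (trans (cong (η (ιHom γ′) a) γx≡x′) γ′x′≡x″) } } }

    Orbits : Presheaf {𝔸}
    Orbits = record
      { F = ~-setoid
      ; act = act (∐y u)
      ; act-cong = λ f {x} (γ , γ∈H , γx≡x′) →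
          γ , γ∈H , trans (natural (ιHom γ) f x) (cong (act (∐y u) f) γx≡x′)
      ; act-id = λ x → ≡⇒~ (Presheaf.act-id (∐y u) x)
      ; act-∘ = λ f g x → ≡⇒~ (Presheaf.act-∘ (∐y u) f g x) }

    toOrbit : NT (∐y u) Orbits
    toOrbit = record { η = λ _ x → x ; η-cong = λ _ → ≡⇒~ ; natural = λ _ _ → ≡⇒~ refl }

    toOrbit-ι : ∀ {α} → mem H α → (toOrbit ∘NT ιHom α) ≈NT toOrbit
    toOrbit-ι {α} α∈H a x = invₛ α , inv∈ H α∈H , ι-invˡ α a x

module _ {𝔸 : Groupoid} (K : Kit 𝔸) where
  open Groupoid 𝔸
  open GroupoidProperties 𝔸
  open Kit K

  conjugate-∈𝒜 : ∀ {a b} (f : Hom a b) {H : Subgroup (End 𝔸 a)} → 𝒜 a H → 𝒜 b (conjugate f H)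
  conjugate-∈𝒜 f {H} = conj f H (conjugate f H) (λ _ δ∈ → δ∈) (λ _ δ∈ → δ∈)

  -- An element of a stabiliser in the orbit presheaf fixes a point (i , f) up to a
  -- γ ∈ H with σ(i) = i, so it is a conjugate of the 1-cycle ⟨γ⟩ᵢ ∈ ⋃ 𝒜(aᵢ).
  Orbits-stable : Boolean 𝔸 K → ∀ {u : SymObj {𝔸}} {H : Subgroup (EndSym u)} → 𝒜Sym K u H →
                  ∀ a (x : El (Orbits H) a) → 𝒜 a (Stab (Orbits H) x)
  Orbits-stable bool {u} {H} H∈𝒜Sym a (i , f) =
    proj₂ (bool a (Stab (Orbits H) (i , f)))
      (⊆⋃⇒⊥⊥ {𝒦 = 𝒜 a} (Stab (Orbits H) (i , f)) Stab⊆⋃𝒜)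
    where
      Stab⊆⋃𝒜 : ∀ δ → mem (Stab (Orbits H) (i , f)) δ → ⋃ (𝒜 a) δ
      Stab⊆⋃𝒜 δ (γ , γ∈H , γ⟨i,f∘δ⟩≡⟨i,f⟩)
        with fixed-point-CycleIn γ (cong proj₁ γ⟨i,f∘δ⟩≡⟨i,f⟩) {⋃ (𝒜 (obj u i))} (H∈𝒜Sym γ γ∈H i)
      ... | L , L∈𝒜 , ⟨γ⟩ᵢ∈L =
        conjugate (f ⁻¹) L , conjugate-∈𝒜 (f ⁻¹) L∈𝒜 ,
        ∈conjugate⁻¹ f L ⟨γ⟩ᵢ∈L
          (,-∘-injectiveʳ {𝔸} {u} (cong proj₁ γ⟨i,f∘δ⟩≡⟨i,f⟩) (comp γ i ∘ id) (f ∘ δ) f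
            (trans (cong (λ h → perm γ ⟨$⟩ʳ i , h ∘ f ∘ δ) (identityʳ (comp γ i)))
                   γ⟨i,f∘δ⟩≡⟨i,f⟩))

  Orbits-St : Boolean 𝔸 K → ∀ {u : SymObj {𝔸}} {H : Subgroup (EndSym u)} → 𝒜Sym K u H → StObj K
  Orbits-St bool {H = H} H∈𝒜Sym =
    record { psh = Orbits H ; stable = Orbits-stable bool {H = H} H∈𝒜Sym }

module FunctorProperties {𝔸 𝔹 : Groupoid} {KA : Kit 𝔸} {KB : Kit 𝔹} (T : StFunctor KA KB) where

  T₁ : ∀ {X Y} → StHom KA X Y → NT (psh (F₀ T X)) (psh (F₀ T Y))
  T₁ f = nt (F₁ T f)

  T₁-∘ : ∀ {X Y Z} {g : StHom KA Y Z} {f : StHom KA X Y} {h : StHom KA X Z} →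
         (g ∘St f) ≈St h → (T₁ g ∘NT T₁ f) ≈NT T₁ h
  T₁-∘ {X} {Z = Z} {g} {f} {h} g∘f≈h = begin
    T₁ g ∘NT T₁ f  ≈⟨ F-∘ T g f ⟨
    T₁ (g ∘St f)   ≈⟨ F-resp T {f = g ∘St f} {g = h} g∘f≈h ⟩
    T₁ h           ∎
    where open SetoidReasoning (NT-setoid (psh (F₀ T X)) (psh (F₀ T Z)))

  T₁-inverse : ∀ {X Y} {g : StHom KA Y X} {f : StHom KA X Y} →
               (g ∘St f) ≈St idSt → (T₁ g ∘NT T₁ f) ≈NT idNT
  T₁-inverse {X} {g = g} {f} g∘f≈id = begin
    T₁ g ∘NT T₁ f  ≈⟨ T₁-∘ {g = g} {f} {idSt} g∘f≈id ⟩
    T₁ idSt        ≈⟨ F-id T ⟩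
    idNT           ∎
    where open SetoidReasoning (NT-setoid (psh (F₀ T X)) (psh (F₀ T X)))

  generic-∘-iso : ∀ {Y Y′ : Presheaf {𝔹}} {X} {g : NT Y (psh (F₀ T X))}
                  (e : NT Y′ Y) (e⁻ : NT Y Y′) → (e ∘NT e⁻) ≈NT idNT → (e⁻ ∘NT e) ≈NT idNT →
                  IsGeneric KA KB T g → IsGeneric KA KB T (g ∘NT e)
  generic-∘-iso {g = g} e e⁻ e∘e⁻≈id e⁻∘e≈id g-generic X′ X″ h f v Th∘g∘e≈Tf∘v
    with g-generic X′ X″ h f (v ∘NT e⁻)
           (switch-toʳ {e = e} {e⁻} e∘e⁻≈id {T₁ h ∘NT g} {T₁ f ∘NT v} Th∘g∘e≈Tf∘v)
  ... | k , f∘k≈h , Tk∘g≈v∘e⁻ , unique =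
    k , f∘k≈h , switch-fromʳ {e = e} {e⁻} e⁻∘e≈id {T₁ k ∘NT g} {v} Tk∘g≈v∘e⁻ ,
    λ k′ f∘k′≈h Tk′∘g∘e≈v →
      unique k′ f∘k′≈h (switch-toʳ {e = e} {e⁻} e∘e⁻≈id {T₁ k′ ∘NT g} {v} Tk′∘g∘e≈v)

  generic-iso-∘ : ∀ {Y : Presheaf {𝔹}} {X X₁} {g : NT Y (psh (F₀ T X))}
                  (j : StHom KA X X₁) (j⁻ : StHom KA X₁ X) →
                  (j⁻ ∘St j) ≈St idSt → (j ∘St j⁻) ≈St idSt →
                  IsGeneric KA KB T g → IsGeneric KA KB T (T₁ j ∘NT g)
  generic-iso-∘ {Y} {X} {g = g} j j⁻ j⁻∘j≈id j∘j⁻≈id g-generic X′ X″ h f v Th∘Tj∘g≈Tf∘v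
    with g-generic X′ X″ (h ∘St j) f v Th∘j∘g≈Tf∘v
    where
      Th∘j∘g≈Tf∘v : (T₁ (h ∘St j) ∘NT g) ≈NT (T₁ f ∘NT v)
      Th∘j∘g≈Tf∘v = begin
        T₁ (h ∘St j) ∘NT g     ≈⟨ ∘NT-congʳ g {T₁ (h ∘St j)} {T₁ h ∘NT T₁ j} (F-∘ T h j) ⟩
        T₁ h ∘NT T₁ j ∘NT g    ≈⟨ Th∘Tj∘g≈Tf∘v ⟩
        T₁ f ∘NT v             ∎
        where open SetoidReasoning (NT-setoid Y (psh (F₀ T X″)))
  ... | k , f∘k≈h∘j , Tk∘g≈v , unique =
    k ∘St j⁻ ,
    switch-fromʳ {e = nt j⁻} {nt j} j∘j⁻≈id {nt (f ∘St k)} {nt h} f∘k≈h∘j ,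
    Tk∘j⁻∘Tj∘g≈v ,
    λ k′ f∘k′≈h Tk′∘Tj∘g≈v →
      switch-toʳ {e = nt j} {nt j⁻} j∘j⁻≈id {nt k′} {nt k}
        (unique (k′ ∘St j) (∘NT-congʳ (nt j) {nt (f ∘St k′)} {nt h} f∘k′≈h)
          (begin
            T₁ (k′ ∘St j) ∘NT g    ≈⟨ ∘NT-congʳ g {T₁ (k′ ∘St j)} {T₁ k′ ∘NT T₁ j} (F-∘ T k′ j) ⟩
            T₁ k′ ∘NT T₁ j ∘NT g   ≈⟨ Tk′∘Tj∘g≈v ⟩
            v                      ∎))
    where
      open SetoidReasoning (NT-setoid Y (psh (F₀ T X′)))
      Tk∘j⁻∘Tj∘g≈v : (T₁ (k ∘St j⁻) ∘NT T₁ j ∘NT g) ≈NT v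
      Tk∘j⁻∘Tj∘g≈v = begin
        T₁ (k ∘St j⁻) ∘NT T₁ j ∘NT g     ≈⟨ ∘NT-congʳ (T₁ j ∘NT g) {T₁ (k ∘St j⁻)} {T₁ k ∘NT T₁ j⁻}
                                               (F-∘ T k j⁻) ⟩
        T₁ k ∘NT (T₁ j⁻ ∘NT T₁ j) ∘NT g  ≈⟨ ∘NT-congˡ (T₁ k) {(T₁ j⁻ ∘NT T₁ j) ∘NT g} {g}
                                               (∘NT-congʳ g {T₁ j⁻ ∘NT T₁ j} {idNT}
                                                 (T₁-inverse {g = j⁻} {j} j⁻∘j≈id)) ⟩
        T₁ k ∘NT g                       ≈⟨ Tk∘g≈v ⟩
        v                                ∎

  generic-cancel : ∀ {Y : Presheaf {𝔹}} {X X′ X″} {g : NT Y (psh (F₀ T X))} →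
                   IsGeneric KA KB T g → (f : StHom KA X′ X″) (k₁ k₂ : StHom KA X X′) →
                   (f ∘St k₁) ≈St (f ∘St k₂) → (T₁ k₁ ∘NT g) ≈NT (T₁ k₂ ∘NT g) → k₁ ≈St k₂
  generic-cancel {Y} {X} {X′} {X″} {g} g-generic f k₁ k₂ f∘k₁≈f∘k₂ Tk₁∘g≈Tk₂∘g
    with g-generic X′ X″ (f ∘St k₁) f (T₁ k₁ ∘NT g)
           (∘NT-congʳ g {T₁ (f ∘St k₁)} {T₁ f ∘NT T₁ k₁} (F-∘ T f k₁))
  ... | k , _ , _ , unique = begin
    nt k₁  ≈⟨ unique k₁ (≈NT.refl {x = nt (f ∘St k₁)}) (≈NT.refl {x = T₁ k₁ ∘NT g}) ⟩
    nt k   ≈⟨ unique k₂ (≈NT.sym {x = nt (f ∘St k₁)} {nt (f ∘St k₂)} f∘k₁≈f∘k₂)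
                        (≈NT.sym {x = T₁ k₁ ∘NT g} {T₁ k₂ ∘NT g} Tk₁∘g≈Tk₂∘g) ⟨
    nt k₂  ∎
    where open SetoidReasoning (NT-setoid (psh X) (psh X′))

module Trace {𝔸 𝔹 : Groupoid} {KA : Kit 𝔸} {KB : Kit 𝔹}
             (boolA : Boolean 𝔸 KA) (T : StFunctor KA KB) where
  module B = Groupoid 𝔹
  open FunctorProperties T

  ∐ : SymObj {𝔸} → StObj KA
  ∐ = ∐St KA boolA

  ι : ∀ {u v} → SymHom u v → StHom KA (∐ u) (∐ v)
  ι α = st (ιHom α)

  Tr : B.Obj → SymObj {𝔸} → Set
  Tr = TrMor boolA T

  tr : ∀ {b′ b u v} → B.Hom b′ b → SymHom u v → Tr b u → Tr b′ v
  tr = trAct boolA T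

  TS : StObj KA → Presheaf {𝔹}
  TS X = psh (F₀ T X)

  Tι-id : ∀ {u} → T₁ (ι (idₛ {u = u})) ≈NT idNT
  Tι-id {u} = begin
    T₁ (ι idₛ)  ≈⟨ F-resp T {f = ι idₛ} {g = idSt} (ι-id {𝔸}) ⟩
    T₁ idSt     ≈⟨ F-id T ⟩
    idNT        ∎
    where open SetoidReasoning (NT-setoid (TS (∐ u)) (TS (∐ u)))

  Tι-∘ : ∀ {u v w} (α₂ : SymHom {𝔸} v w) (α₁ : SymHom u v) →
         T₁ (ι (α₂ ∘ₛ α₁)) ≈NT (T₁ (ι α₂) ∘NT T₁ (ι α₁))
  Tι-∘ {u} {w = w} α₂ α₁ = begin
    T₁ (ι (α₂ ∘ₛ α₁))        ≈⟨ F-resp T {f = ι (α₂ ∘ₛ α₁)} {g = ι α₂ ∘St ι α₁} (ι-∘ α₂ α₁) ⟩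
    T₁ (ι α₂ ∘St ι α₁)       ≈⟨ F-∘ T (ι α₂) (ι α₁) ⟩
    T₁ (ι α₂) ∘NT T₁ (ι α₁)  ∎
    where open SetoidReasoning (NT-setoid (TS (∐ u)) (TS (∐ w)))

  module _ {b′ b : B.Obj} {u v : SymObj {𝔸}} where
    open SetoidReasoning (NT-setoid (y {𝔹} b′) (TS (∐ v)))

    trAct-cong : (β : B.Hom b′ b) {α α′ : SymHom u v} {g g′ : Tr b u} →
                 ιHom α ≈NT ιHom α′ → g ≈NT g′ → tr β α g ≈NT tr β α′ g′
    trAct-cong β {α} {α′} {g} {g′} ια≈ια′ g≈g′ = begin
      T₁ (ι α) ∘NT g ∘NT yHom β    ≈⟨ ∘NT-congˡ (T₁ (ι α)) {g ∘NT yHom β} {g′ ∘NT yHom β}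
                                        (∘NT-congʳ (yHom β) {g} {g′} g≈g′) ⟩
      T₁ (ι α) ∘NT g′ ∘NT yHom β   ≈⟨ ∘NT-congʳ (g′ ∘NT yHom β) {T₁ (ι α)} {T₁ (ι α′)}
                                        (F-resp T {f = ι α} {g = ι α′} ια≈ια′) ⟩
      T₁ (ι α′) ∘NT g′ ∘NT yHom β  ∎

  trAct-id : ∀ {b u} (g : Tr b u) → tr B.id idₛ g ≈NT g
  trAct-id {b} {u} g = begin
    T₁ (ι idₛ) ∘NT g ∘NT yHom B.id  ≈⟨ ∘NT-congʳ (g ∘NT yHom B.id) {T₁ (ι idₛ)} {idNT} Tι-id ⟩
    g ∘NT yHom B.id                 ≈⟨ ∘NT-congˡ g {yHom B.id} {idNT} (yHom-id {𝔹}) ⟩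
    g                               ∎
    where open SetoidReasoning (NT-setoid (y {𝔹} b) (TS (∐ u)))

  trAct-∘ : ∀ {b″ b′ b u v w} (β₂ : B.Hom b″ b′) (β₁ : B.Hom b′ b)
            (α₂ : SymHom v w) (α₁ : SymHom u v) (g : Tr b u) →
            tr (β₁ B.∘ β₂) (α₂ ∘ₛ α₁) g ≈NT tr β₂ α₂ (tr β₁ α₁ g)
  trAct-∘ {b″} {w = w} β₂ β₁ α₂ α₁ g = begin
    T₁ (ι (α₂ ∘ₛ α₁)) ∘NT g ∘NT yHom (β₁ B.∘ β₂)
      ≈⟨ ∘NT-congʳ (g ∘NT yHom (β₁ B.∘ β₂)) {T₁ (ι (α₂ ∘ₛ α₁))} {T₁ (ι α₂) ∘NT T₁ (ι α₁)}
           (Tι-∘ α₂ α₁) ⟩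
    T₁ (ι α₂) ∘NT T₁ (ι α₁) ∘NT g ∘NT yHom (β₁ B.∘ β₂)
      ≈⟨ ∘NT-congˡ (T₁ (ι α₂) ∘NT T₁ (ι α₁) ∘NT g) {yHom (β₁ B.∘ β₂)} {yHom β₁ ∘NT yHom β₂}
           (yHom-∘ {𝔹} β₁ β₂) ⟩
    T₁ (ι α₂) ∘NT T₁ (ι α₁) ∘NT g ∘NT yHom β₁ ∘NT yHom β₂
      ∎
    where open SetoidReasoning (NT-setoid (y {𝔹} b″) (TS (∐ w)))

  trAct-generic : ∀ {b′ b u v} (β : B.Hom b′ b) (α : SymHom u v) (g : Tr b u) →
                  IsGeneric KA KB T g → IsGeneric KA KB T (tr β α g)
  trAct-generic β α g g-generic =
    generic-iso-∘ {g = g ∘NT yHom β} (ι α) (ι (invₛ α)) (ι-invˡ {𝔸} α) (ι-invʳ {𝔸} α)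
      (generic-∘-iso {g = g} (yHom β) (yHom (β B.⁻¹)) (yHom-inverseʳ {𝔹} β) (yHom-inverseˡ {𝔹} β)
        g-generic)

  Fixes : ∀ {b u} → Tr b u → B.Hom b b → SymHom u u → Set
  Fixes g β α = tr β α g ≈NT g

  module _ {b : B.Obj} {u : SymObj {𝔸}} {g : Tr b u} where
    open SetoidReasoning (NT-setoid (y {𝔹} b) (TS (∐ u)))

    fixes-≈ₛ : ∀ {β α α′} → α ≈ₛ α′ → Fixes g β α → Fixes g β α′
    fixes-≈ₛ {β} {α} {α′} α≈α′ g-fixed = begin
      tr β α′ g  ≈⟨ trAct-cong β {α′} {α} {g} {g}
                      (≈NT.sym {x = ιHom α} {ιHom α′} (ι-resp {𝔸} {u} {u} {α} {α′} α≈α′))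
                      (≈NT.refl {x = g}) ⟩
      tr β α g   ≈⟨ g-fixed ⟩
      g          ∎

    fixes-∘ : ∀ {β₁ β₂ α₁ α₂} → Fixes g β₁ α₁ → Fixes g β₂ α₂ → Fixes g (β₁ B.∘ β₂) (α₂ ∘ₛ α₁)
    fixes-∘ {β₁} {β₂} {α₁} {α₂} g-fixed₁ g-fixed₂ = begin
      tr (β₁ B.∘ β₂) (α₂ ∘ₛ α₁) g  ≈⟨ trAct-∘ β₂ β₁ α₂ α₁ g ⟩
      tr β₂ α₂ (tr β₁ α₁ g)        ≈⟨ trAct-cong β₂ {α₂} {α₂} {tr β₁ α₁ g} {g}
                                        (≈NT.refl {x = ιHom α₂}) g-fixed₁ ⟩
      tr β₂ α₂ g                   ≈⟨ g-fixed₂ ⟩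
      g                            ∎

    fixes-⁻¹ : ∀ {β α} → Fixes g β α → Fixes g (β B.⁻¹) (invₛ α)
    fixes-⁻¹ {β} {α} g-fixed = begin
      tr (β B.⁻¹) (invₛ α) g
        ≈⟨ trAct-cong (β B.⁻¹) {invₛ α} {invₛ α} {g} {tr β α g}
             (≈NT.refl {x = ιHom (invₛ α)}) (≈NT.sym {x = tr β α g} {g} g-fixed) ⟩
      (T₁ (ι (invₛ α)) ∘NT T₁ (ι α)) ∘NT g ∘NT yHom β ∘NT yHom (β B.⁻¹)
        ≈⟨ ∘NT-congʳ (g ∘NT yHom β ∘NT yHom (β B.⁻¹)) {T₁ (ι (invₛ α)) ∘NT T₁ (ι α)} {idNT}
             (T₁-inverse {g = ι (invₛ α)} {ι α} (ι-invˡ {𝔸} α)) ⟩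
      g ∘NT yHom β ∘NT yHom (β B.⁻¹)
        ≈⟨ ∘NT-congˡ g {yHom β ∘NT yHom (β B.⁻¹)} {idNT} (yHom-inverseʳ {𝔹} β) ⟩
      g ∎

    fixes-id⇒Tι∘g≈g : ∀ {α} → Fixes g B.id α → (T₁ (ι α) ∘NT g) ≈NT g
    fixes-id⇒Tι∘g≈g {α} g-fixed = begin
      T₁ (ι α) ∘NT g               ≈⟨ ∘NT-congˡ (T₁ (ι α) ∘NT g) {yHom B.id} {idNT} (yHom-id {𝔹}) ⟨
      T₁ (ι α) ∘NT g ∘NT yHom B.id  ≈⟨ g-fixed ⟩
      g                            ∎

  invariant-fixes⇒⋃ℬ : ∀ {b u} {Z : StObj KA} (g : Tr b u) {α β} (q : StHom KA (∐ u) Z) →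
                        (q ∘St ι α) ≈St q → Fixes g β α → ⋃ (Kit.𝒜 KB b) β
  invariant-fixes⇒⋃ℬ {b} {Z = Z} g {α} {β} q q∘ια≈q g-fixed =
    Stab (TS Z) (η (T₁ q ∘NT g) b B.id) , stable (F₀ T Z) b _ ,
    yoneda-Stab (T₁ q ∘NT g) Tq∘g∘β≈Tq∘g
    where
      open SetoidReasoning (NT-setoid (y {𝔹} b) (TS Z))
      Tq∘g∘β≈Tq∘g : (T₁ q ∘NT g ∘NT yHom β) ≈NT (T₁ q ∘NT g)
      Tq∘g∘β≈Tq∘g = begin
        T₁ q ∘NT g ∘NT yHom β             ≈⟨ ∘NT-congʳ (g ∘NT yHom β) {T₁ q ∘NT T₁ (ι α)} {T₁ q}
                                               (T₁-∘ {g = q} {ι α} {q} q∘ια≈q) ⟨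
        T₁ q ∘NT T₁ (ι α) ∘NT g ∘NT yHom β  ≈⟨ ∘NT-congˡ (T₁ q) {tr β α g} {g} g-fixed ⟩
        T₁ q ∘NT g                        ∎

  toOrbit-St : ∀ {u} {H : Subgroup (EndSym u)} (H∈𝒜Sym : 𝒜Sym KA u H) →
               StHom KA (∐ u) (Orbits-St KA boolA {H = H} H∈𝒜Sym)
  toOrbit-St {H = H} _ = st (toOrbit H)

  -- T(ι α) ∘ g = g and ι α is invisible in the H-orbits, so genericity forces ι α = id.
  generic-fixes⇒≈idₛ : ∀ {b u} {g : Tr b u} → IsGeneric KA KB T g →
                        ∀ {H α} → 𝒜Sym KA u H → mem H α → Fixes g B.id α → α ≈ₛ idₛ
  generic-fixes⇒≈idₛ {b} {u} {g} g-generic {H} {α} H∈𝒜Sym α∈H g-fixed =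
    ι≈id⇒≈ₛidₛ {𝔸} {u} {α}
      (generic-cancel {g = g} g-generic (toOrbit-St {H = H} H∈𝒜Sym) (ι α) idSt (toOrbit-ι H α∈H)
        (begin
        T₁ (ι α) ∘NT g  ≈⟨ fixes-id⇒Tι∘g≈g {g = g} {α} g-fixed ⟩
        g               ≈⟨ ∘NT-congʳ g {T₁ idSt} {idNT} (F-id T) ⟨
        T₁ idSt ∘NT g   ∎))
    where open SetoidReasoning (NT-setoid (y {𝔹} b) (TS (∐ u)))

  module _ {b : B.Obj} {u : SymObj {𝔸}} (g : Tr b u) where

    symPartners : Subgroup (End 𝔹 b) → Subgroup (EndSym u)
    symPartners K = record
      { mem = λ α → Σ[ β ∈ B.Hom b b ] (mem K β × Fixes g β α)
      ; mem-resp = λ { {α} {α′} α≈α′ (β , β∈K , g-fixed) →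
                       β , β∈K , fixes-≈ₛ {g = g} {β} {α} {α′} α≈α′ g-fixed }
      ; ε∈ = B.id , ε∈ K , trAct-id g
      ; ·∈ = λ { {α₁} {α₂} (β₁ , β₁∈K , g-fixed₁) (β₂ , β₂∈K , g-fixed₂) →
                 β₂ B.∘ β₁ , ·∈ K β₂∈K β₁∈K ,
                 fixes-∘ {g = g} {β₂} {β₁} {α₂} {α₁} g-fixed₂ g-fixed₁ }
      ; inv∈ = λ { {α} (β , β∈K , g-fixed) →
                   β B.⁻¹ , inv∈ K β∈K , fixes-⁻¹ {g = g} {β} {α} g-fixed } }

    basePartners : Subgroup (EndSym u) → Subgroup (End 𝔹 b)
    basePartners H = record
      { mem = λ β → Σ[ α ∈ SymHom u u ] (mem H α × Fixes g β α)
      ; mem-resp = λ { refl β∈ → β∈ }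
      ; ε∈ = idₛ , ε∈ H , trAct-id g
      ; ·∈ = λ { {β₁} {β₂} (α₁ , α₁∈H , g-fixed₁) (α₂ , α₂∈H , g-fixed₂) →
                 α₂ ∘ₛ α₁ , ·∈ H α₂∈H α₁∈H , fixes-∘ {g = g} {β₁} {β₂} {α₁} {α₂} g-fixed₁ g-fixed₂ }
      ; inv∈ = λ { {β} (α , α∈H , g-fixed) →
                   invₛ α , inv∈ H α∈H , fixes-⁻¹ {g = g} {β} {α} g-fixed } }

    symPartners-⊥ : IsGeneric KA KB T g → ∀ {K} → (Kit.𝒜 KB b ⊥) K →
                    (𝒜Sym KA u ⊥) (symPartners K)
    symPartners-⊥ g-generic {K} K∈ℬ⊥ L L∈𝒜Sym α (β , β∈K , g-fixed) α∈L =
      generic-fixes⇒≈idₛ {g = g} g-generic {L} {α} L∈𝒜Sym α∈L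
        (subst (λ β′ → Fixes g β′ α) β≡id g-fixed)
      where
        β≡id : β ≡ B.id
        β≡id = ⊥-∩-⋃⇒≈ε {𝒦 = Kit.𝒜 KB b} {K} K∈ℬ⊥ β∈K
                 (invariant-fixes⇒⋃ℬ g {α} {β} (toOrbit-St {H = L} L∈𝒜Sym) (toOrbit-ι L α∈L)
                    g-fixed)

    trace-stable-⊥ : IsGeneric KA KB T g → (α : SymHom u u) (β : B.Hom b b) → Fixes g β α →
                     ⋃ (Kit.𝒜 KB b ⊥) β → ⋃ (!𝒜 KA u ⊥) α
    trace-stable-⊥ g-generic α β g-fixed (K , K∈ℬ⊥ , β∈K) =
      symPartners K ,
      ⊥⇒⊥⊥⊥ {𝒦 = 𝒜Sym KA u} {symPartners K} (symPartners-⊥ g-generic {K} K∈ℬ⊥) ,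
      (β , β∈K , g-fixed)

    trace-stable-! : Boolean 𝔹 KB → IsGeneric KA KB T g → (α : SymHom u u) (β : B.Hom b b) →
                     Fixes g β α → ⋃ (!𝒜 KA u) α → ⋃ (Kit.𝒜 KB b) β
    trace-stable-! boolB g-generic α β g-fixed (H , H∈!𝒜 , α∈H) =
      basePartners H , proj₂ (boolB b (basePartners H)) basePartners∈ℬ⊥⊥ , (α , α∈H , g-fixed)
      where
        basePartners∈ℬ⊥⊥ : ((Kit.𝒜 KB b ⊥) ⊥) (basePartners H)
        basePartners∈ℬ⊥⊥ K K∈ℬ⊥ β′ (α′ , α′∈H , g-fixed′) β′∈K =
          ⊥-∩-⋃⇒≈ε {𝒦 = Kit.𝒜 KB b} {K} K∈ℬ⊥ β′∈K
            (invariant-fixes⇒⋃ℬ g {idₛ} {β′} idSt (ι-id {𝔸} {u})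
              (fixes-≈ₛ {g = g} {β′} {α′} {idₛ}
                 (H∈!𝒜 (symPartners K) (symPartners-⊥ g-generic {K} K∈ℬ⊥) α′ α′∈H
                    (β′ , β′∈K , g-fixed′))
                 g-fixed′))

proposition8p14 : (𝔸 𝔹 : Groupoid) (KA : Kit 𝔸) (KB : Kit 𝔹) →
    (boolA : Boolean 𝔸 KA) → Boolean 𝔹 KB →
    (T : StFunctor KA KB) → IsStableFunctor KA KB T →
    TraceIsStableSpecies boolA T
proposition8p14 𝔸 𝔹 KA KB boolA boolB T _ = record
  { gen-closed = trAct-generic
  ; resp-el = λ β α g g′ _ _ → trAct-cong β {α} {α} {g} {g′} (≈NT.refl {x = ιHom α})
  ; resp-hom = λ β α α′ g _ α≈α′ →
      trAct-cong β {α} {α′} {g} {g} (ι-resp {𝔸} {α = α} {α′} α≈α′) (≈NT.refl {x = g})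
  ; act-id = λ g _ → trAct-id g
  ; act-∘ = λ β₂ β₁ α₂ α₁ g _ → trAct-∘ β₂ β₁ α₂ α₁ g
  ; stable-! = λ g g-generic → trace-stable-! g boolB g-generic
  ; stable-⊥ = λ g g-generic → trace-stable-⊥ g g-generic }
  where open Trace boolA T
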